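{- For any time warps $f,g$ and $p\in\overline{\omega}$: (a) $(f\backslash g)(p)=0$ if $p=0$; $(f\backslash g)(p)=\bigvee\{q\in\overline{\omega}\mid f(q)\le g(p)\}$ if $p\in\omega\setminus\{0\}$; and $(f\backslash g)(p)=\bigvee\{q\in\overline{\omega}\mid \exists m\in\omega,\ f(q)\le g(m)\}$ if $p=\omega$. (b) $(g/f)(p)=\bigwedge g[\{q\in\overline{\omega}\mid p\le f(q)\}]$ (the infimum of the image under $g$ of that set, with $\bigwedge\emptyset=\omega$).
   Context: Let $\overline{\omega}=\omega\cup\{\omega\}$ with its natural order. A time warp is a function $f:\overline{\omega}\to\overline{\omega}$ preserving all suprema; equivalently, a monotone function with $f(0)=0$ and $f(\omega)=\bigvee\{f(n)\mid n\in\omega\}$. The set $W$ of time warps is ordered pointwise; $fg:=f\circ g$. The residuals $\backslash,/$ are the binary operations on $W$ satisfying $f\le h/g \iff fg\le h\iff g\le f\backslash h$ for all $f,g,h\in W$. -}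

module Defs where

open import Data.Nat using (ℕ; zero; suc; _≤_)
open import Data.Product using (Σ; _×_; ∃)
open import Relation.Binary.PropositionalEquality using (_≡_)
open import Function.Bundles using (_⇔_)

data ℕ∞ : Set where
  fin : ℕ → ℕ∞
  ω   : ℕ∞

data _≤∞_ : ℕ∞ → ℕ∞ → Set where
  fin≤fin : ∀ {m n} → m ≤ n → fin m ≤∞ fin n
  _≤ω     : ∀ x → x ≤∞ ω

Subset∞ : Set₁
Subset∞ = ℕ∞ → Set

IsSup : Subset∞ → ℕ∞ → Set
IsSup S x = (∀ y → S y → y ≤∞ x) × (∀ z → (∀ y → S y → y ≤∞ z) → x ≤∞ z)

-- x is the infimum (greatest lower bound) of S  (inf of ∅ is ω)
IsInf : Subset∞ → ℕ∞ → Set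
IsInf S x = (∀ y → S y → x ≤∞ y) × (∀ z → (∀ y → S y → z ≤∞ y) → z ≤∞ x)

record TimeWarp : Set where
  field
    fun    : ℕ∞ → ℕ∞
    mono   : ∀ {x y} → x ≤∞ y → fun x ≤∞ fun y
    strict : fun (fin zero) ≡ fin zero
    cont   : IsSup (λ y → ∃ λ n → y ≡ fun (fin n)) (fun ω)
open TimeWarp public

_≤W_ : TimeWarp → TimeWarp → Set
f ≤W g = ∀ p → fun f p ≤∞ fun g p

_∘≤_ : (ℕ∞ → ℕ∞) → TimeWarp → Set
φ ∘≤ g = ∀ p → φ p ≤∞ fun g p

-- h = f \ g :  ∀ k ∈ W,  k ≤ h ⇔ f k ≤ g
IsLeftDiv : TimeWarp → TimeWarp → TimeWarp → Set
IsLeftDiv f g h = ∀ k → (k ≤W h) ⇔ ((λ p → fun f (fun k p)) ∘≤ g)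

-- h = g / f :  ∀ k ∈ W,  k ≤ h ⇔ k f ≤ g
IsRightDiv : TimeWarp → TimeWarp → TimeWarp → Set
IsRightDiv g f h = ∀ k → (k ≤W h) ⇔ ((λ p → fun k (fun f p)) ∘≤ g)

-- Both residuals are computed by testing them against step warps, which are 0 up
-- to some M and constantly v afterwards: the residual property turns each
-- description of the residual into a statement about such a step.  The only delicate
-- value is (g / f)(ω), where the relevant q satisfy f(q) = ω.  For a finite c
-- below the claimed infimum one needs an N with f(q) ≥ N ⇒ c ≤ g(q); if f(ω) is
-- finite any N beyond it works, and otherwise c ≤ g(ω) forces c ≤ g(m) for some m
-- and N is taken above the finite values among f(0), …, f(m-1).  That m is found
-- only under a double negation, which is harmless because ≤ on ω̄ is decidable.
module Submission where

open import Defs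
open import Data.Nat using (ℕ; zero; suc; _≤_; _<_; _≤?_; _⊔_; z≤n)
open import Data.Product using (_×_; ∃; _,_; proj₂)
open import Data.Nat.Properties
  using (≤-refl; ≤-trans; ≰⇒>; 1+n≰n; n≤1+n; m≤m⊔n; m≤n⊔m; m<1+n⇒m<n∨m≡n)
open import Data.Sum using (_⊎_; inj₁; inj₂; map₁)
open import Data.Empty using (⊥-elim)
open import Relation.Nullary using (¬_; Dec; yes; no)
open import Relation.Nullary.Decidable using (decidable-stable)
open import Relation.Binary.PropositionalEquality using (_≡_; refl; sym; subst)
open import Function.Bundles using (Equivalence)

≤∞-refl : ∀ {x} → x ≤∞ x
≤∞-refl {fin n} = fin≤fin ≤-refl
≤∞-refl {ω}     = ω ≤ω

≤∞-reflexive : ∀ {x y} → x ≡ y → x ≤∞ y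
≤∞-reflexive refl = ≤∞-refl

≤∞-trans : ∀ {x y z} → x ≤∞ y → y ≤∞ z → x ≤∞ z
≤∞-trans {x} _           (_ ≤ω)      = x ≤ω
≤∞-trans (fin≤fin m≤n) (fin≤fin n≤o) = fin≤fin (≤-trans m≤n n≤o)

0≤∞ : ∀ x → fin 0 ≤∞ x
0≤∞ (fin n) = fin≤fin z≤n
0≤∞ ω       = fin 0 ≤ω

1+n≰∞n : ∀ {n} → ¬ (fin (suc n) ≤∞ fin n)
1+n≰∞n (fin≤fin 1+n≤n) = 1+n≰n 1+n≤n

≰∞⇒≤∞pred : ∀ {n} x → ¬ (fin (suc n) ≤∞ x) → x ≤∞ fin n
≰∞⇒≤∞pred {n} (fin m) 1+n≰m with m ≤? n
... | yes m≤n = fin≤fin m≤n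
... | no  m≰n = ⊥-elim (1+n≰m (fin≤fin (≰⇒> m≰n)))
≰∞⇒≤∞pred ω 1+n≰ω = ⊥-elim (1+n≰ω (_ ≤ω))

_≤∞?_ : ∀ x y → Dec (x ≤∞ y)
fin m ≤∞? fin n with m ≤? n
... | yes m≤n = yes (fin≤fin m≤n)
... | no  m≰n = no λ { (fin≤fin m≤n) → m≰n m≤n }
x     ≤∞? ω     = yes (x ≤ω)
ω     ≤∞? fin n = no λ ()

≤∞-byFinite : ∀ {x y} → (∀ c → fin c ≤∞ x → fin c ≤∞ y) → x ≤∞ y
≤∞-byFinite {fin c} below = below c ≤∞-refl
≤∞-byFinite {ω} {fin n} below = ⊥-elim (1+n≰∞n (below (suc n) (fin (suc n) ≤ω)))
≤∞-byFinite {ω} {ω}     _     = ω ≤ω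

¬¬finite≤sup⇒≤term : (s : ℕ → ℕ∞) {x : ℕ∞} → IsSup (λ y → ∃ λ n → y ≡ s n) x →
                     ∀ {c} → fin c ≤∞ x → ¬ ¬ (∃ λ m → fin c ≤∞ s m)
¬¬finite≤sup⇒≤term s         _       {zero}  _    none = none (0 , 0≤∞ (s 0))
¬¬finite≤sup⇒≤term s (_ , least) {suc c} c≤x none =
  1+n≰∞n (≤∞-trans c≤x (least (fin c) λ { _ (m , refl) → ≰∞⇒≤∞pred (s m) (λ le → none (m , le)) }))

finiteValues-bounded : (s : ℕ → ℕ∞) (m : ℕ) →
                       ∃ λ B → ∀ {j} → j < m → s j ≤∞ fin B ⊎ s j ≡ ω
finiteValues-bounded s zero = 0 , λ ()
finiteValues-bounded s (suc m) with finiteValues-bounded s m | s m in sm≡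
... | B , bounded | fin a = B ⊔ a , bounded′
  where
  bounded′ : ∀ {j} → j < suc m → s j ≤∞ fin (B ⊔ a) ⊎ s j ≡ ω
  bounded′ j<1+m with m<1+n⇒m<n∨m≡n j<1+m
  ... | inj₁ j<m  = map₁ (λ le → ≤∞-trans le (fin≤fin (m≤m⊔n B a))) (bounded j<m)
  ... | inj₂ refl = inj₁ (≤∞-trans (≤∞-reflexive sm≡) (fin≤fin (m≤n⊔m B a)))
... | B , bounded | ω = B , bounded′
  where
  bounded′ : ∀ {j} → j < suc m → s j ≤∞ fin B ⊎ s j ≡ ω
  bounded′ j<1+m with m<1+n⇒m<n∨m≡n j<1+m
  ... | inj₁ j<m  = bounded j<m
  ... | inj₂ refl = inj₂ sm≡

step : ℕ → ℕ∞ → ℕ∞ → ℕ∞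
step M v (fin x) with x ≤? M
... | yes _ = fin 0
... | no  _ = v
step M v ω = v

step-elim : (P : ℕ∞ → Set) {M : ℕ} {v : ℕ∞} → P (fin 0) →
            ∀ x → (fin (suc M) ≤∞ x → P v) → P (step M v x)
step-elim P {M} at0 (fin x) above with x ≤? M
... | yes _   = at0
... | no  x≰M = above (fin≤fin (≰⇒> x≰M))
step-elim P {M} at0 ω above = above (fin (suc M) ≤ω)

step-above : ∀ {M v x} → fin (suc M) ≤∞ x → step M v x ≡ v
step-above {M} {x = fin x} (fin≤fin 1+M≤x) with x ≤? M
... | yes x≤M = ⊥-elim (1+n≰n (≤-trans 1+M≤x x≤M))
... | no  _   = refl
step-above {x = ω} _ = refl

step-zero : ∀ M v → step M v (fin 0) ≡ fin 0
step-zero M v with 0 ≤? M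
... | yes _   = refl
... | no  0≰M = ⊥-elim (0≰M z≤n)

step≤value : ∀ M v x → step M v x ≤∞ v
step≤value M v x = step-elim (_≤∞ v) (0≤∞ v) x (λ _ → ≤∞-refl)

step-mono : ∀ M v {x y} → x ≤∞ y → step M v x ≤∞ step M v y
step-mono M v {x} {y} x≤y =
  step-elim (_≤∞ step M v y) (0≤∞ _) x
    (λ M<x → ≤∞-reflexive (sym (step-above (≤∞-trans M<x x≤y))))

stepWarp : ℕ → ℕ∞ → TimeWarp
stepWarp M v = record
  { fun    = step M v
  ; mono   = step-mono M v
  ; strict = step-zero M v
  ; cont   = (λ { _ (n , refl) → step≤value M v (fin n) })
           , (λ z ub → subst (_≤∞ z) (step-above ≤∞-refl) (ub _ (suc M , refl)))
  }

module LeftDiv (f g h : TimeWarp) (isLeftDiv : IsLeftDiv f g h) where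

  cancel : ∀ p → fun f (fun h p) ≤∞ fun g p
  cancel = Equivalence.to (isLeftDiv h) (λ _ → ≤∞-refl)

  stepWarp≤ : ∀ {M v} → fun f v ≤∞ fun g (fin (suc M)) → stepWarp M v ≤W h
  stepWarp≤ {M} {v} fv≤g = Equivalence.from (isLeftDiv (stepWarp M v)) below
    where
    below : ∀ p → fun f (step M v p) ≤∞ fun g p
    below p = step-elim (λ y → fun f y ≤∞ fun g p)
                (≤∞-trans (≤∞-reflexive (strict f)) (0≤∞ _)) p
                (λ M<p → ≤∞-trans fv≤g (mono g M<p))

  ≤at-suc : ∀ {n q} → fun f q ≤∞ fun g (fin (suc n)) → q ≤∞ fun h (fin (suc n))
  ≤at-suc fq≤g = subst (_≤∞ _) (step-above ≤∞-refl) (stepWarp≤ fq≤g _)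

  ≤atω : ∀ {m q} → fun f q ≤∞ fun g (fin m) → q ≤∞ fun h ω
  ≤atω {m} fq≤g = stepWarp≤ {M = m} (≤∞-trans fq≤g (mono g (fin≤fin (n≤1+n m)))) ω

  supAtSuc : ∀ n → IsSup (λ q → fun f q ≤∞ fun g (fin (suc n))) (fun h (fin (suc n)))
  supAtSuc n = (λ _ → ≤at-suc) , λ _ ub → ub _ (cancel (fin (suc n)))

  supAtω : IsSup (λ q → ∃ λ m → fun f q ≤∞ fun g (fin m)) (fun h ω)
  supAtω = (λ { _ (_ , fq≤gm) → ≤atω fq≤gm })
         , (λ z ub → proj₂ (cont h) z λ { _ (n , refl) → ub _ (n , cancel (fin n)) })

module RightDiv (f g h : TimeWarp) (isRightDiv : IsRightDiv g f h) where

  cancel : ∀ p → fun h (fun f p) ≤∞ fun g p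
  cancel = Equivalence.to (isRightDiv h) (λ _ → ≤∞-refl)

  stepWarp≤ : ∀ {M v} → (∀ q → fin (suc M) ≤∞ fun f q → v ≤∞ fun g q) → stepWarp M v ≤W h
  stepWarp≤ {M} {v} eventually = Equivalence.from (isRightDiv (stepWarp M v)) below
    where
    below : ∀ q → step M v (fun f q) ≤∞ fun g q
    below q = step-elim (_≤∞ fun g q) (0≤∞ _) (fun f q) (eventually q)

  finite≤atω : ∀ {c} → (∀ q → ω ≤∞ fun f q → fin c ≤∞ fun g q) → fin c ≤∞ fun h ω
  finite≤atω {c} atω = decidable-stable (fin c ≤∞? fun h ω) (viaSupremum (fun f ω) refl)
    where
    viaThreshold : ∀ M → (∀ q → fin (suc M) ≤∞ fun f q → fin c ≤∞ fun g q) → fin c ≤∞ fun h ω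
    viaThreshold M eventually = stepWarp≤ eventually ω

    viaTerm : ∀ m → fin c ≤∞ fun g (fin m) → fin c ≤∞ fun h ω
    viaTerm m c≤gm with finiteValues-bounded (λ j → fun f (fin j)) m
    ... | B , bounded = viaThreshold B eventually
      where
      eventually : ∀ q → fin (suc B) ≤∞ fun f q → fin c ≤∞ fun g q
      eventually ω _ = ≤∞-trans c≤gm (mono g (_ ≤ω))
      eventually (fin j) B<fj with m ≤? j
      ... | yes m≤j = ≤∞-trans c≤gm (mono g (fin≤fin m≤j))
      ... | no  m≰j with bounded (≰⇒> m≰j)
      ...   | inj₁ fj≤B = ⊥-elim (1+n≰∞n (≤∞-trans B<fj fj≤B))
      ...   | inj₂ fj≡ω = atω (fin j) (≤∞-reflexive (sym fj≡ω))

    viaSupremum : ∀ x → x ≡ fun f ω → ¬ ¬ (fin c ≤∞ fun h ω)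
    viaSupremum (fin B) fω≡B c≰hω = c≰hω (viaThreshold B λ q B<fq →
      ⊥-elim (1+n≰∞n (≤∞-trans B<fq (≤∞-trans (mono f (q ≤ω)) (≤∞-reflexive (sym fω≡B))))))
    viaSupremum ω fω≡ω c≰hω =
      ¬¬finite≤sup⇒≤term (λ n → fun g (fin n)) (cont g) (atω ω (≤∞-reflexive fω≡ω))
        (λ { (m , c≤gm) → c≰hω (viaTerm m c≤gm) })

  greatest : ∀ p z → (∀ y → (∃ λ q → (p ≤∞ fun f q) × (y ≡ fun g q)) → z ≤∞ y) → z ≤∞ fun h p
  greatest (fin zero) z lb = subst (z ≤∞_) (sym (strict h))
    (subst (z ≤∞_) (strict g) (lb _ (fin 0 , 0≤∞ _ , refl)))
  greatest (fin (suc n)) z lb = subst (_≤∞ _) (step-above ≤∞-refl)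
    (stepWarp≤ (λ q n<fq → lb _ (q , n<fq , refl)) (fin (suc n)))
  greatest ω z lb = ≤∞-byFinite λ c c≤z → finite≤atω λ q ω≤fq → ≤∞-trans c≤z (lb _ (q , ω≤fq , refl))

  infAt : ∀ p → IsInf (λ y → ∃ λ q → (p ≤∞ fun f q) × (y ≡ fun g q)) (fun h p)
  infAt p = (λ { _ (q , p≤fq , refl) → ≤∞-trans (mono h p≤fq) (cancel q) }) , greatest p

lemma2p1 : (f g : TimeWarp) →
    ((h : TimeWarp) → IsLeftDiv f g h →
      (fun h (fin zero) ≡ fin zero)
      × (∀ n → IsSup (λ q → fun f q ≤∞ fun g (fin (suc n))) (fun h (fin (suc n))))
      × IsSup (λ q → ∃ λ m → fun f q ≤∞ fun g (fin m)) (fun h ω))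
    × ((h : TimeWarp) → IsRightDiv g f h →
      ∀ p → IsInf (λ y → ∃ λ q → (p ≤∞ fun f q) × (y ≡ fun g q)) (fun h p))
lemma2p1 f g =
    (λ h isLeftDiv → strict h , LeftDiv.supAtSuc f g h isLeftDiv , LeftDiv.supAtω f g h isLeftDiv)
  , (λ h isRightDiv → RightDiv.infAt f g h isRightDiv)
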